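{- Let $G$ be a connected graph and $H$ a connected graph containing $G$ as an isometric subgraph such that every peripheral vertex of $H$ belongs to $V(G)$. Then $\delta(G)=\delta(H)$.
   Context: Graphs are finite, simple, with shortest-path metric $d$. The interval $I(x,y)=\{v: d(x,y)=d(x,v)+d(v,y)\}$. A vertex $x$ of $H$ is peripheral if there is a vertex $y$ such that $I(y,x)\not\subset I(y,z)$ for all vertices $z\ne x$. A subgraph $G$ of $H$ is isometric if $d_G(u,v)=d_H(u,v)$ for all $u,v\in V(G)$. A graph is $\delta$-hyperbolic if for any four vertices $u,v,w,x$ the two largest of $d(u,v)+d(w,x)$, $d(u,x)+d(v,w)$, $d(u,w)+d(v,x)$ differ by at most $2\delta$; $\delta(G)$ is the smallest such $\delta$. -}

module Defs where

open import Data.Nat using (ℕ; zero; suc; _+_; _∸_; _≤_; _⊔_; _⊓_)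
open import Data.Bool using (Bool; true; false; _∧_; _∨_; if_then_else_)
open import Data.Fin using (Fin; _≟_)
open import Data.Fin.Properties using (any?)
open import Data.Product using (Σ; ∃; _×_; _,_)
open import Relation.Nullary using (¬_; does)
open import Relation.Binary.PropositionalEquality using (_≡_; _≢_)
open import Function.Definitions using (Injective)

record Graph : Set where
  field
    n     : ℕ
    adj   : Fin n → Fin n → Bool
    sym   : ∀ u v → adj u v ≡ adj v u
    irrefl : ∀ u → adj u u ≡ false

open Graph public

V : Graph → Set
V G = Fin (n G)

data Walk (G : Graph) : V G → V G → ℕ → Set where
  here : ∀ {u} → Walk G u u 0
  step : ∀ {u v w k} → adj G u v ≡ true → Walk G v w k → Walk G u w (suc k)

Connected : Graph → Set
Connected G = ∀ (u v : V G) → ∃ λ k → Walk G u v k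

anyFin : ∀ {m} → (Fin m → Bool) → Bool
anyFin {zero} p = false
anyFin {suc m} p = p Fin.zero ∨ anyFin {m} (λ i → p (Fin.suc i))

reachWithin : (G : Graph) → ℕ → V G → V G → Bool
reachWithin G zero u v = does (u ≟ v)
reachWithin G (suc k) u v =
  reachWithin G k u v ∨ anyFin (λ w → reachWithin G k u w ∧ adj G w v)

-- least j ≥ i (searching `fuel` more steps) with reachWithin G j u v; default i + fuel.
search : (G : Graph) → V G → V G → ℕ → ℕ → ℕ
search G u v i zero = i
search G u v i (suc fuel) =
  if reachWithin G i u v then i else search G u v (suc i) fuel

-- Shortest-path distance d_G(u,v) (correct for connected graphs, where d < n).
dist : (G : Graph) → V G → V G → ℕ
dist G u v = search G u v 0 (n G)

InInterval : (G : Graph) → V G → V G → V G → Set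
InInterval G x y v = dist G x y ≡ dist G x v + dist G v y

IntervalSubset : (G : Graph) → V G → V G → V G → V G → Set
IntervalSubset G a b c e = ∀ v → InInterval G a b v → InInterval G c e v

Peripheral : (G : Graph) → V G → Set
Peripheral G x = ∃ λ (y : V G) → ∀ (z : V G) → z ≢ x → ¬ IntervalSubset G y x y z

record IsometricSubgraph (G H : Graph) : Set where
  field
    f         : V G → V H
    injective : Injective _≡_ _≡_ f
    edges     : ∀ u v → adj G u v ≡ true → adj H (f u) (f v) ≡ true
    isometric : ∀ u v → dist H (f u) (f v) ≡ dist G u v

open IsometricSubgraph public

mid3 : ℕ → ℕ → ℕ → ℕ
mid3 a b c = (a ⊓ b) ⊔ ((a ⊔ b) ⊓ c)

max3 : ℕ → ℕ → ℕ → ℕ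
max3 a b c = a ⊔ b ⊔ c

-- G is (k/2)-hyperbolic: the two largest of the three sums differ by at most k = 2δ.
Hyperbolic2 : (G : Graph) → ℕ → Set
Hyperbolic2 G k = ∀ (u v w x : V G) →
  let s₁ = dist G u v + dist G w x
      s₂ = dist G u x + dist G v w
      s₃ = dist G u w + dist G v x
  in max3 s₁ s₂ s₃ ∸ mid3 s₁ s₂ s₃ ≤ k

-- k = 2 δ(G): the least k such that G is (k/2)-hyperbolic.
IsTwiceDelta : Graph → ℕ → Set
IsTwiceDelta G k = Hyperbolic2 G k × (∀ j → Hyperbolic2 G j → k ≤ j)

module Submission where

-- Write the four-point condition for one quadruple as
--   FourPoint u v w x :  d(u,v) + d(w,x) ≤ max (d(u,x) + d(v,w)) (d(u,w) + d(v,x)) + k.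
-- A graph is (k/2)-hyperbolic exactly when FourPoint holds for all quadruples
-- (the gap between the two largest of three numbers is ≤ k iff each of them is at
-- most k above the larger of the other two).  Distances of G agree with those of H,
-- so hyperbolicity always passes from H down to G.  For the converse we prove
-- FourPoint in H by upward induction on d(u,v) + d(w,x), which is bounded by 2|V(H)|.
-- If x is not peripheral as seen from w, some z ≠ x has I(w,x) ⊆ I(w,z); then
-- x ∈ I(w,z), so d(w,z) = d(w,x) + d(x,z) is larger, and FourPoint at (u,v,w,z)
-- together with the triangle inequality gives it at (u,v,w,x).  By the symmetries of
-- FourPoint the same works for u, v and w.  If none of the four vertices can be
-- pushed outward they are all peripheral, hence in G, where hyperbolicity of G applies.
-- As both implications hold for every k, the least admissible k agrees for G and H.

open import Defs hiding (sym)
open import Defs using () renaming (sym to adj-sym)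
open import Data.Nat using (ℕ; zero; suc; _+_; _∸_; _≤_; _<_; _⊔_; _⊓_; z≤n; s≤s)
open import Data.Nat.Properties
  using ( ≤-refl; ≤-reflexive; ≤-trans; ≤-antisym; ≰⇒≥; _≤?_; n≮n; n≤0⇒n≡0
        ; n≢0⇒n>0; m≤n⇒m<n∨m≡n; m≤m+n; m≤n+m; m≤n+m∸n; m≤n+o⇒m∸n≤o; ∸-monoʳ-<
        ; +-identityʳ; +-suc; +-comm; +-assoc; +-monoˡ-≤; +-monoʳ-≤; +-mono-≤; +-monoʳ-<
        ; +-cancelʳ-≤; +-distribʳ-⊔; m≤m⊔n; m≤n⊔m; ⊔-lub; ⊔-comm; ⊔-mono-≤; ⊓-comm
        ; ⊓-mono-≤; m⊓n≤n; m≤n⇒m⊓n≡m; m≥n⇒m⊓n≡n; module ≤-Reasoning )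
open import Data.Nat.Induction using (<-rec)
open import Data.Bool using (Bool; true; false; _∧_; _∨_)
open import Data.Bool.Properties using (∨-zeroʳ)
open import Data.Fin using (Fin; _≟_)
open import Data.Fin.Properties using (any?; all?)
open import Data.Product using (∃; _×_; _,_)
open import Data.Sum using (_⊎_; inj₁; inj₂)
open import Relation.Nullary using (¬_; Dec; yes; no; ¬?)
open import Relation.Nullary.Decidable using (_×-dec_; _→-dec_)
open import Relation.Nullary.Negation using (contradiction)
open import Relation.Binary.PropositionalEquality
  using (_≡_; _≢_; refl; sym; trans; cong; cong₂; subst)

anyFin-intro : ∀ {m} (p : Fin m → Bool) i → p i ≡ true → anyFin p ≡ true
anyFin-intro p Fin.zero e rewrite e = refl
anyFin-intro p (Fin.suc i) e rewrite anyFin-intro (λ j → p (Fin.suc j)) i e = ∨-zeroʳ (p Fin.zero)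

anyFin-elim : ∀ {m} (p : Fin m → Bool) → anyFin p ≡ true → ∃ λ i → p i ≡ true
anyFin-elim {zero} p ()
anyFin-elim {suc m} p e with p Fin.zero in eq
... | true = Fin.zero , eq
... | false with anyFin-elim (λ j → p (Fin.suc j)) e
...   | i , e' = Fin.suc i , e'

∨-introˡ : ∀ {a b} → a ≡ true → a ∨ b ≡ true
∨-introˡ refl = refl

∨-introʳ : ∀ a {b} → b ≡ true → a ∨ b ≡ true
∨-introʳ true e = refl
∨-introʳ false e = e

∨-elim : ∀ a {b} → a ∨ b ≡ true → (a ≡ true) ⊎ (b ≡ true)
∨-elim true e = inj₁ refl
∨-elim false e = inj₂ e

∧-intro : ∀ {a b} → a ≡ true → b ≡ true → a ∧ b ≡ true
∧-intro refl refl = refl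

∧-elim : ∀ a {b} → a ∧ b ≡ true → (a ≡ true) × (b ≡ true)
∧-elim true e = refl , e
∧-elim false ()

-- Metric facts for the search-based distance of an arbitrary graph: it is
-- symmetric, satisfies the triangle inequality, vanishes exactly on the diagonal
-- and never exceeds the number of vertices.
module Distance (G : Graph) where

  private
    R : ℕ → V G → V G → Bool
    R = reachWithin G

    N : ℕ
    N = n G

    d : V G → V G → ℕ
    d = dist G

  reach-refl : ∀ u → R 0 u u ≡ true
  reach-refl u with u ≟ u
  ... | yes _ = refl
  ... | no u≢u = contradiction refl u≢u

  reach-zero : ∀ {u v} → R 0 u v ≡ true → u ≡ v
  reach-zero {u} {v} e with u ≟ v
  ... | yes u≡v = u≡v
  reach-zero {u} {v} () | no _

  reach-snoc : ∀ k {u w v} → R k u w ≡ true → adj G w v ≡ true → R (suc k) u v ≡ true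
  reach-snoc k {u} {w} {v} e a =
    ∨-introʳ (R k u v) (anyFin-intro (λ w' → R k u w' ∧ adj G w' v) w (∧-intro e a))

  reach-concat : ∀ j k {a b c} → R j a b ≡ true → R k b c ≡ true → R (j + k) a c ≡ true
  reach-concat j zero {a} e₁ e₂ rewrite +-identityʳ j =
    subst (λ x → R j a x ≡ true) (reach-zero e₂) e₁
  reach-concat j (suc k) {a} {b} {c} e₁ e₂ rewrite +-suc j k with ∨-elim (R k b c) e₂
  ... | inj₁ e = ∨-introˡ (reach-concat j k e₁ e)
  ... | inj₂ e with anyFin-elim _ e
  ...   | w , e' with ∧-elim (R k b w) e'
  ...     | e₃ , wc = reach-snoc (j + k) (reach-concat j k e₁ e₃) wc

  reach-sym : ∀ k {a b} → R k a b ≡ true → R k b a ≡ true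
  reach-sym zero {a} {b} e = subst (λ x → R 0 x a ≡ true) (reach-zero {a} {b} e) (reach-refl a)
  reach-sym (suc k) {a} {b} e with ∨-elim (R k a b) e
  ... | inj₁ e' = ∨-introˡ (reach-sym k e')
  ... | inj₂ e' with anyFin-elim _ e'
  ...   | w , e'' with ∧-elim (R k a w) e''
  ...     | e₃ , wb = reach-concat 1 k {b} {w} {a} (reach-snoc 0 {b} {b} {w} (reach-refl b) (trans (adj-sym G b w) wb))
                                      (reach-sym k e₃)

  search-bounded : ∀ u v i fuel → search G u v i fuel ≤ i + fuel
  search-bounded u v i zero = ≤-reflexive (sym (+-identityʳ i))
  search-bounded u v i (suc fuel) with R i u v
  ... | true = m≤m+n i _
  ... | false = ≤-trans (search-bounded u v (suc i) fuel) (≤-reflexive (sym (+-suc i fuel)))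

  search-least : ∀ u v i fuel j → R j u v ≡ true → i ≤ j → search G u v i fuel ≤ j
  search-least u v i zero j e i≤j = i≤j
  search-least u v i (suc fuel) j e i≤j with R i u v in eq
  ... | true = i≤j
  ... | false = search-least u v (suc i) fuel j e i<j
    where
    i<j : suc i ≤ j
    i<j with m≤n⇒m<n∨m≡n i≤j
    ... | inj₁ lt = lt
    ... | inj₂ refl with trans (sym eq) e
    ...   | ()

  search-found : ∀ u v i fuel → search G u v i fuel < i + fuel → R (search G u v i fuel) u v ≡ true
  search-found u v i zero lt = contradiction (≤-trans lt (≤-reflexive (+-identityʳ i))) (n≮n i)
  search-found u v i (suc fuel) lt with R i u v in eq
  ... | true = eq
  ... | false = search-found u v (suc i) fuel (≤-trans lt (≤-reflexive (+-suc i fuel)))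

  dist≤n : ∀ u v → d u v ≤ N
  dist≤n u v = search-bounded u v 0 N

  dist-least : ∀ {u v} j → R j u v ≡ true → d u v ≤ j
  dist-least {u} {v} j e = search-least u v 0 N j e z≤n

  dist-realised : ∀ {u v} → d u v < N → R (d u v) u v ≡ true
  dist-realised {u} {v} lt = search-found u v 0 N lt

  dist-sym≤ : ∀ u v → d v u ≤ d u v
  dist-sym≤ u v with m≤n⇒m<n∨m≡n (dist≤n u v)
  ... | inj₁ lt = dist-least (d u v) (reach-sym (d u v) (dist-realised lt))
  ... | inj₂ eq = ≤-trans (dist≤n v u) (≤-reflexive (sym eq))

  dist-sym : ∀ u v → d u v ≡ d v u
  dist-sym u v = ≤-antisym (dist-sym≤ v u) (dist-sym≤ u v)

  dist-triangle : ∀ a b c → d a c ≤ d a b + d b c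
  dist-triangle a b c with m≤n⇒m<n∨m≡n (dist≤n a b) | m≤n⇒m<n∨m≡n (dist≤n b c)
  ... | inj₁ ab | inj₁ bc =
    dist-least _ (reach-concat (d a b) (d b c) (dist-realised ab) (dist-realised bc))
  ... | inj₂ ab | _ = ≤-trans (dist≤n a c) (≤-trans (≤-reflexive (sym ab)) (m≤m+n _ _))
  ... | _ | inj₂ bc = ≤-trans (dist≤n a c) (≤-trans (≤-reflexive (sym bc)) (m≤n+m _ _))

  dist-refl : ∀ a → d a a ≡ 0
  dist-refl a = n≤0⇒n≡0 (dist-least 0 (reach-refl a))

  dist≡0⇒≡ : ∀ {a b} → d a b ≡ 0 → a ≡ b
  dist≡0⇒≡ {a} {b} e =
    reach-zero (subst (λ j → R j a b ≡ true) e (dist-realised (subst (_< N) (sym e) (nonempty a))))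
    where
    nonempty : Fin N → 0 < N
    nonempty Fin.zero = s≤s z≤n
    nonempty (Fin.suc _) = s≤s z≤n

spread≤⇒dominated : ∀ a b c k → max3 a b c ∸ mid3 a b c ≤ k → a ≤ (b ⊔ c) + k
spread≤⇒dominated a b c k spread = begin
  a                      ≤⟨ ≤-trans (m≤m⊔n a b) (m≤m⊔n (a ⊔ b) c) ⟩
  max3 a b c             ≤⟨ m≤n+m∸n (max3 a b c) (mid3 a b c) ⟩
  mid3 a b c + (max3 a b c ∸ mid3 a b c) ≤⟨ +-monoʳ-≤ (mid3 a b c) spread ⟩
  mid3 a b c + k         ≤⟨ +-monoˡ-≤ k (⊔-mono-≤ (m⊓n≤n a b) (m⊓n≤n (a ⊔ b) c)) ⟩
  (b ⊔ c) + k            ∎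
  where open ≤-Reasoning

-- If x exceeds max y z by at most k and both x ⊓ y and x ⊓ z are ≤ m,
-- then x ≤ m + k (whichever of y, z is below x is itself below m).
≤-via-minima : ∀ x y z m k → x ⊓ y ≤ m → x ⊓ z ≤ m → x ≤ (y ⊔ z) + k → x ≤ m + k
≤-via-minima x y z m k xy xz dom with x ≤? y | x ≤? z
... | yes x≤y | _ = ≤-trans (≤-trans (≤-reflexive (sym (m≤n⇒m⊓n≡m x≤y))) xy) (m≤m+n m k)
... | no _ | yes x≤z = ≤-trans (≤-trans (≤-reflexive (sym (m≤n⇒m⊓n≡m x≤z))) xz) (m≤m+n m k)
... | no x≰y | no x≰z = ≤-trans dom (+-monoˡ-≤ k (⊔-lub
      (≤-trans (≤-reflexive (sym (m≥n⇒m⊓n≡n (≰⇒≥ x≰y)))) xy)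
      (≤-trans (≤-reflexive (sym (m≥n⇒m⊓n≡n (≰⇒≥ x≰z)))) xz)))

dominated⇒spread≤ : ∀ a b c k → a ≤ (b ⊔ c) + k → b ≤ (a ⊔ c) + k → c ≤ (a ⊔ b) + k →
                    max3 a b c ∸ mid3 a b c ≤ k
dominated⇒spread≤ a b c k da db dc =
  m≤n+o⇒m∸n≤o (max3 a b c) M (⊔-lub (⊔-lub a≤ b≤) c≤)
  where
  M = mid3 a b c
  ab : a ⊓ b ≤ M
  ab = m≤m⊔n (a ⊓ b) _
  ac : a ⊓ c ≤ M
  ac = ≤-trans (⊓-mono-≤ (m≤m⊔n a b) ≤-refl) (m≤n⊔m (a ⊓ b) _)
  bc : b ⊓ c ≤ M
  bc = ≤-trans (⊓-mono-≤ (m≤n⊔m a b) ≤-refl) (m≤n⊔m (a ⊓ b) _)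
  a≤ : a ≤ M + k
  a≤ = ≤-via-minima a b c M k ab ac da
  b≤ : b ≤ M + k
  b≤ = ≤-via-minima b a c M k (subst (_≤ M) (⊓-comm a b) ab) bc db
  c≤ : c ≤ M + k
  c≤ = ≤-via-minima c a b M k (subst (_≤ M) (⊓-comm a c) ac) (subst (_≤ M) (⊓-comm b c) bc) dc

-- Hyperbolicity is inherited by isometric subgraphs: the three pair sums of a
-- quadruple of G are literally those of its image in H.
hyperbolic-restricts : ∀ {G H} (S : IsometricSubgraph G H) {j} → Hyperbolic2 H j → Hyperbolic2 G j
hyperbolic-restricts S hypH u v w x
  rewrite sym (isometric S u v) | sym (isometric S w x) | sym (isometric S u x)
        | sym (isometric S v w) | sym (isometric S u w) | sym (isometric S v x)
  = hypH (f S u) (f S v) (f S w) (f S x)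

module FourPointCondition (H : Graph) (k : ℕ) where

  open Distance H
  open ≤-Reasoning

  private
    d : V H → V H → ℕ
    d = dist H

  FourPoint : V H → V H → V H → V H → Set
  FourPoint u v w x = d u v + d w x ≤ (d u x + d v w) ⊔ (d u w + d v x) + k

  fourPoint-swap : ∀ {u v w x} → FourPoint u v w x → FourPoint u v x w
  fourPoint-swap {u} {v} {w} {x} fp = begin
    d u v + d x w                         ≡⟨ cong (d u v +_) (dist-sym x w) ⟩
    d u v + d w x                         ≤⟨ fp ⟩
    (d u x + d v w) ⊔ (d u w + d v x) + k ≡⟨ cong (_+ k) (⊔-comm (d u x + d v w) _) ⟩
    (d u w + d v x) ⊔ (d u x + d v w) + k ∎

  fourPoint-exchange : ∀ {u v w x} → FourPoint u v w x → FourPoint w x u v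
  fourPoint-exchange {u} {v} {w} {x} fp = begin
    d w x + d u v                         ≡⟨ +-comm (d w x) (d u v) ⟩
    d u v + d w x                         ≤⟨ fp ⟩
    (d u x + d v w) ⊔ (d u w + d v x) + k ≡⟨ cong₂ (λ a b → a ⊔ b + k) ux+vw uw+vx ⟩
    (d w v + d x u) ⊔ (d w u + d x v) + k ∎
    where
    ux+vw : d u x + d v w ≡ d w v + d x u
    ux+vw = trans (+-comm (d u x) (d v w)) (cong₂ _+_ (dist-sym v w) (dist-sym u x))
    uw+vx : d u w + d v x ≡ d w u + d x v
    uw+vx = cong₂ _+_ (dist-sym u w) (dist-sym v x)

  -- FourPoint for every quadruple is (k/2)-hyperbolicity: each of the three pair
  -- sums is one of its instances.
  fourPoint⇒hyperbolic : (∀ u v w x → FourPoint u v w x) → Hyperbolic2 H k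
  fourPoint⇒hyperbolic fp u v w x = dominated⇒spread≤ _ _ _ k (fp u v w x) ux+vw uw+vx
    where
    ux+vw : d u x + d v w ≤ (d u v + d w x) ⊔ (d u w + d v x) + k
    ux+vw = begin
      d u x + d v w                         ≡⟨ cong (d u x +_) (dist-sym v w) ⟩
      d u x + d w v                         ≤⟨ fp u x w v ⟩
      (d u v + d x w) ⊔ (d u w + d x v) + k ≡⟨ cong₂ (λ a b → (d u v + a) ⊔ (d u w + b) + k)
                                                      (dist-sym x w) (dist-sym x v) ⟩
      (d u v + d w x) ⊔ (d u w + d v x) + k ∎
    uw+vx : d u w + d v x ≤ (d u v + d w x) ⊔ (d u x + d v w) + k
    uw+vx = begin
      d u w + d v x                         ≤⟨ fp u w v x ⟩
      (d u x + d w v) ⊔ (d u v + d w x) + k ≡⟨ cong (_+ k) (⊔-comm (d u x + d w v) _) ⟩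
      (d u v + d w x) ⊔ (d u x + d w v) + k ≡⟨ cong (λ a → (d u v + d w x) ⊔ (d u x + a) + k)
                                                    (dist-sym w v) ⟩
      (d u v + d w x) ⊔ (d u x + d v w) + k ∎

  -- z pushes x outward as seen from w: z ≠ x and I(w,x) ⊆ I(w,z).
  -- x is peripheral exactly when, for some w, no vertex pushes it outward.
  Pushes : V H → V H → V H → Set
  Pushes w x z = z ≢ x × IntervalSubset H w x w z

  pushes? : ∀ w x → Dec (∃ (Pushes w x))
  pushes? w x = any? λ z → ¬? (z ≟ x) ×-dec all? λ v →
    (d w x Data.Nat.≟ d w v + d v x) →-dec (d w z Data.Nat.≟ d w v + d v z)

  unpushable⇒peripheral : ∀ w x → ¬ ∃ (Pushes w x) → Peripheral H x
  unpushable⇒peripheral w x none = w , λ z z≢x sub → none (z , z≢x , sub)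

  -- Since x ∈ I(w,x) ⊆ I(w,z), a geodesic from w to z passes through x.
  pushes-through : ∀ {w x z} → Pushes w x z → d w z ≡ d w x + d x z
  pushes-through {w} {x} (_ , sub) = sub x (sym (trans (cong (d w x +_) (dist-refl x)) (+-identityʳ _)))

  pushes-lengthens : ∀ {w x z} → Pushes w x z → d w x < d w z
  pushes-lengthens {w} {x} {z} p@(z≢x , _) = begin-strict
    d w x           ≡⟨ sym (+-identityʳ _) ⟩
    d w x + 0       <⟨ +-monoʳ-< (d w x) (n≢0⇒n>0 λ dxz≡0 → z≢x (sym (dist≡0⇒≡ dxz≡0))) ⟩
    d w x + d x z   ≡⟨ sym (pushes-through p) ⟩
    d w z           ∎

  -- Pulling the last vertex back from z to x costs t = d(x,z) on the left and at
  -- most t on the right (triangle inequality), so FourPoint survives.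
  fourPoint-pullback : ∀ {u v w x z} → Pushes w x z → FourPoint u v w z → FourPoint u v w x
  fourPoint-pullback {u} {v} {w} {x} {z} p fp = +-cancelʳ-≤ t (d u v + d w x) (M + k) (begin
    d u v + d w x + t       ≡⟨ +-assoc (d u v) (d w x) t ⟩
    d u v + (d w x + t)     ≡⟨ cong (d u v +_) (sym (pushes-through p)) ⟩
    d u v + d w z           ≤⟨ fp ⟩
    M' + k                  ≤⟨ +-monoˡ-≤ k M'≤M+t ⟩
    M + t + k               ≡⟨ +-assoc M t k ⟩
    M + (t + k)             ≡⟨ cong (M +_) (+-comm t k) ⟩
    M + (k + t)             ≡⟨ sym (+-assoc M k t) ⟩
    M + k + t               ∎)
    where
    t = d x z
    M = (d u x + d v w) ⊔ (d u w + d v x)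
    M' = (d u z + d v w) ⊔ (d u w + d v z)
    shift : ∀ {a a' b} → a' ≤ a + t → a' + b ≤ a + b + t
    shift {a} {a'} {b} le = ≤-trans (+-monoˡ-≤ b le) (≤-reflexive (trans (+-assoc a t b)
      (trans (cong (a +_) (+-comm t b)) (sym (+-assoc a b t)))))
    M'≤M+t : M' ≤ M + t
    M'≤M+t = ≤-trans
      (⊔-mono-≤ (shift (dist-triangle u x z))
                (≤-trans (+-monoʳ-≤ (d u w) (dist-triangle v x z))
                         (≤-reflexive (sym (+-assoc (d u w) (d v x) t)))))
      (≤-reflexive (sym (+-distribʳ-⊔ t (d u x + d v w) (d u w + d v x))))

bounded-upward-induction : ∀ {a p} {A : Set a} (P : A → Set p) (size : A → ℕ) (B : ℕ) →
  (∀ x → size x ≤ B) → (∀ x → (∀ y → size x < size y → P y) → P x) → ∀ x → P x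
bounded-upward-induction P size B bounded larger⇒holds x = <-rec Q prove (B ∸ size x) x refl
  where
  Q : ℕ → Set _
  Q m = ∀ x → B ∸ size x ≡ m → P x
  prove : ∀ m → (∀ {m'} → m' < m → Q m') → Q m
  prove _ rec x refl = larger⇒holds x λ y lt → rec (∸-monoʳ-< lt (bounded y)) y refl

module Lifting (G H : Graph) (S : IsometricSubgraph G H)
  (peripheral-in-G : ∀ (x : V H) → Peripheral H x → ∃ λ (u : V G) → f S u ≡ x)
  (k : ℕ) (hypG : Hyperbolic2 G k) where

  open Distance H
  open FourPointCondition H k

  private
    d : V H → V H → ℕ
    d = dist H

  Quadruple : Set
  Quadruple = V H × V H × V H × V H

  span : Quadruple → ℕ
  span (u , v , w , x) = d u v + d w x

  Holds : Quadruple → Set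
  Holds (u , v , w , x) = FourPoint u v w x

  span-bounded : ∀ q → span q ≤ n H + n H
  span-bounded (u , v , w , x) = +-mono-≤ (dist≤n u v) (dist≤n w x)

  fourPoint-on-G : ∀ u v w x → FourPoint (f S u) (f S v) (f S w) (f S x)
  fourPoint-on-G u v w x
    rewrite isometric S u v | isometric S w x | isometric S u x
          | isometric S v w | isometric S u w | isometric S v x
    = spread≤⇒dominated _ _ _ k (hypG u v w x)

  -- One induction step: push some vertex outward (which strictly increases the
  -- span) and pull back, or else all four vertices are peripheral and lie in G.
  fourPoint-step : ∀ q → (∀ q' → span q < span q' → Holds q') → Holds q
  fourPoint-step (u , v , w , x) IH with pushes? w x | pushes? x w | pushes? v u | pushes? u v
  ... | yes (z , p) | _ | _ | _ =
    fourPoint-pullback p (IH (u , v , w , z) (+-monoʳ-< (d u v) (pushes-lengthens p)))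
  ... | no _ | yes (z , p) | _ | _ =
    fourPoint-swap (fourPoint-pullback p (IH (u , v , x , z)
      (subst (_< d u v + d x z) (cong (d u v +_) (dist-sym x w))
             (+-monoʳ-< (d u v) (pushes-lengthens p)))))
  ... | no _ | no _ | yes (z , p) | _ =
    fourPoint-exchange (fourPoint-swap (fourPoint-pullback p (IH (w , x , v , z)
      (subst (_< d w x + d v z) (trans (cong (d w x +_) (dist-sym v u)) (+-comm (d w x) (d u v)))
             (+-monoʳ-< (d w x) (pushes-lengthens p))))))
  ... | no _ | no _ | no _ | yes (z , p) =
    fourPoint-exchange (fourPoint-pullback p (IH (w , x , u , z)
      (subst (_< d w x + d u z) (+-comm (d w x) (d u v))
             (+-monoʳ-< (d w x) (pushes-lengthens p)))))
  ... | no x⊥ | no w⊥ | no u⊥ | no v⊥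
    with peripheral-in-G u (unpushable⇒peripheral v u u⊥)
       | peripheral-in-G v (unpushable⇒peripheral u v v⊥)
       | peripheral-in-G w (unpushable⇒peripheral x w w⊥)
       | peripheral-in-G x (unpushable⇒peripheral w x x⊥)
  ... | u' , refl | v' , refl | w' , refl | x' , refl = fourPoint-on-G u' v' w' x'

  hyperbolic-lifts : Hyperbolic2 H k
  hyperbolic-lifts = fourPoint⇒hyperbolic λ u v w x →
    bounded-upward-induction Holds span (n H + n H) span-bounded fourPoint-step (u , v , w , x)

proposition5 : (G H : Graph) → Connected G → Connected H →
    (S : IsometricSubgraph G H) →
    (∀ (x : V H) → Peripheral H x → ∃ λ (u : V G) → f S u ≡ x) →
    ∀ (k : ℕ) → (IsTwiceDelta G k → IsTwiceDelta H k) × (IsTwiceDelta H k → IsTwiceDelta G k)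
proposition5 G H _ _ S per k = G⇒H , H⇒G
  where
  up : ∀ {j} → Hyperbolic2 G j → Hyperbolic2 H j
  up {j} = Lifting.hyperbolic-lifts G H S per j

  down : ∀ {j} → Hyperbolic2 H j → Hyperbolic2 G j
  down = hyperbolic-restricts S

  G⇒H : IsTwiceDelta G k → IsTwiceDelta H k
  G⇒H (hypG , leastG) = up hypG , λ j hypH → leastG j (down hypH)

  H⇒G : IsTwiceDelta H k → IsTwiceDelta G k
  H⇒G (hypH , leastH) = down hypH , λ j hypG → leastH j (up hypG)
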